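{- Let $F$ be rule $12$ on the triangular grid, let $c$ be a configuration and $u$ a cell, and suppose the distance $d$ from $u$ to the nearest cell that is active in $c$ satisfies $d\ge2$. Let $v\in N(u)$. Then $F^{d-1}(c)_v=1$ if and only if there exists a cell $w\in S_v\cap D_d(u)$ with $c_w=1$.
   Context: Triangular grid: the plane tessellated by equilateral triangles; each triangle (cell) has three neighbors, the triangles sharing an edge with it; $N(u)$ is the set of neighbors of $u$. Distance between cells is graph distance in the graph of cells with edges between neighbors; $D_r(u)$ is the set of cells at distance exactly $r$ from $u$. For a neighbor $v$ of $u$, the line containing the common edge of the triangles $u$ and $v$ divides the grid into two half-planes (each cell lies entirely on one side); $S_v$ is the set of cells in the half-plane containing $v$. A configuration assigns each cell a state in $\{0,1\}$ (1 = active, 0 = inactive). Rule $12$ is the synchronous map $F(c)_u=1$ if $c_u=1$ or $\sum_{v\in N(u)}c_v\in\{1,2\}$, and $F(c)_u=0$ otherwise. -}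

module Defs where

open import Data.Bool using (Bool; true; false; _∨_)
open import Data.Nat using (ℕ; zero; suc; _≤_; _<_; _≡ᵇ_)
import Data.Nat as ℕ
open import Data.Integer using (ℤ; _+_; _-_; 1ℤ; _≤_)
import Data.Integer as ℤ
open import Data.Fin using (Fin; zero; suc)
open import Data.Product using (_×_; ∃-syntax)
open import Relation.Binary.PropositionalEquality using (_≡_)
open import Relation.Nullary using (¬_)

-- A cell is a triple (x , y , z) ∈ ℤ³ with x + y + z ∈ {1 , 2}
-- (the standard "three-line-family" coordinates: the triangle (x,y,z) lies between
-- the grid lines X = x-1, X = x ; Y = y-1, Y = y ; Z = z-1, Z = z).
-- We store x, y and the orientation (sum 1 = lo, sum 2 = hi); z is derived.
data Ori : Set where
  lo hi : Ori

record Cell : Set where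
  constructor cell
  field
    x : ℤ
    y : ℤ
    o : Ori
open Cell public

osum : Ori → ℤ
osum lo = ℤ.+ 1
osum hi = ℤ.+ 2

coord : Cell → Fin 3 → ℤ
coord c zero = x c
coord c (suc zero) = y c
coord c (suc (suc zero)) = osum (o c) - x c - y c

-- the three neighbours of a cell (the triangles sharing an edge with it):
-- a lo cell's neighbours increase one coordinate by 1, a hi cell's decrease one by 1.
nbr : Cell → Fin 3 → Cell
nbr (cell a b lo) zero = cell (a + 1ℤ) b hi
nbr (cell a b lo) (suc zero) = cell a (b + 1ℤ) hi
nbr (cell a b lo) (suc (suc zero)) = cell a b hi
nbr (cell a b hi) zero = cell (a - 1ℤ) b lo
nbr (cell a b hi) (suc zero) = cell a (b - 1ℤ) lo
nbr (cell a b hi) (suc (suc zero)) = cell a b lo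

_∈N_ : Cell → Cell → Set
v ∈N u = ∃[ i ] v ≡ nbr u i

data Walk : Cell → Cell → ℕ → Set where
  here : ∀ {u} → Walk u u 0
  step : ∀ {u w n} (i : Fin 3) → Walk (nbr u i) w n → Walk u w (suc n)

Dist : Cell → Cell → ℕ → Set
Dist u w r = Walk u w r × (∀ m → m ℕ.< r → ¬ Walk u w m)

_∈D[_]_ : Cell → ℕ → Cell → Set
w ∈D[ r ] u = Dist u w r

-- S_v for v = nbr u i: the common edge of u and v lies on the line
-- "coordinate i = coord u i" (u lo) resp. "coordinate i = coord u i - 1" (u hi);
-- S_v is the side of that line containing v.
InS : Cell → Fin 3 → Cell → Set
InS (cell a b lo) i w = coord (nbr (cell a b lo) i) i ℤ.≤ coord w i
InS (cell a b hi) i w = coord w i ℤ.≤ coord (nbr (cell a b hi) i) i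

Config : Set
Config = Cell → Bool

b2n : Bool → ℕ
b2n true = 1
b2n false = 0

activeNbrs : Config → Cell → ℕ
activeNbrs c u = b2n (c (nbr u zero)) ℕ.+ b2n (c (nbr u (suc zero)))
                   ℕ.+ b2n (c (nbr u (suc (suc zero))))

rule12 : Config → Config
rule12 c u = c u ∨ ((activeNbrs c u ≡ᵇ 1) ∨ (activeNbrs c u ≡ᵇ 2))

iter : ∀ {A : Set} → (A → A) → ℕ → A → A
iter f zero a = a
iter f (suc n) a = f (iter f n a)

NearestActiveDist : Config → Cell → ℕ → Set
NearestActiveDist c u d =
  (∃[ w ] (c w ≡ true × Dist u w d)) ×
  (∀ w e → c w ≡ true → Dist u w e → d ℕ.≤ e)

-- A cell is a triple (x , y , z) of integers with x + y + z ∈ {1 , 2}; moving to a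
-- neighbour changes exactly one coordinate by ±1.  The graph distance is therefore the
-- ℓ¹ distance 'dist' of these triples: a step changes 'dist' by exactly one, and it
-- decreases precisely when the target lies in the half-plane S of that step
-- ('dist-toward', 'dist-away'); from every cell other than the target some step points
-- towards it ('toward-or-equal'), so greedy walks realise 'dist' ('dist-Dist').
--
-- Two facts about rule 12 are needed: activity spreads at speed at most one
-- ('light-cone'), and a cell with an active and an inactive neighbour becomes active
-- ('local12-fires').  If the nearest active cell w of u is at distance d, induction on k
-- shows that every cell x at distance k < d from w on a geodesic from u to w is active
-- at time k ('wavefront'): its neighbour towards w is active by induction, while its
-- neighbour towards u is still inactive by the light cone.  Applied to the neighbour v
-- of u this gives one direction of the theorem; the light cone together with the
-- half-plane criterion gives the other.  The argument works for every d ≥ 1.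
module Submission where

open import Defs
open import Data.Bool using (Bool; true; false; _∨_)
open import Data.Nat using (ℕ; zero; suc; _≤_; _<_; _∸_; _≡ᵇ_; z≤n; s≤s)
import Data.Nat as ℕ
import Data.Nat.Properties as ℕP
import Data.Nat.Tactic.RingSolver as ℕSolver
open import Data.Integer using (ℤ; +_; -[1+_]; 1ℤ; -1ℤ; 0ℤ; ∣_∣; +≤+; -≤+)
import Data.Integer as ℤ
import Data.Integer.Properties as ℤP
open import Data.Integer.Tactic.RingSolver using (solve-∀)
open import Data.Fin using (Fin; zero; suc)
open import Data.Product using (_×_; _,_; ∃-syntax)
open import Data.Sum using (_⊎_; inj₁; inj₂)
open import Data.Empty using (⊥-elim)
open import Function.Bundles using (_⇔_; mk⇔)
open import Relation.Nullary using (¬_; Dec; yes; no)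
open import Relation.Binary.PropositionalEquality

sign : Ori → ℤ
sign lo = 1ℤ
sign hi = -1ℤ

coord-nbr-same : ∀ a i → coord (nbr a i) i ≡ sign (o a) ℤ.+ coord a i
coord-nbr-same (cell p q lo) zero = ℤP.+-comm p 1ℤ
coord-nbr-same (cell p q lo) (suc zero) = ℤP.+-comm q 1ℤ
coord-nbr-same (cell p q lo) (suc (suc zero)) = third p q
  where
  third : ∀ p q → + 2 ℤ.- p ℤ.- q ≡ 1ℤ ℤ.+ (+ 1 ℤ.- p ℤ.- q)
  third = solve-∀
coord-nbr-same (cell p q hi) zero = ℤP.+-comm p -1ℤ
coord-nbr-same (cell p q hi) (suc zero) = ℤP.+-comm q -1ℤ
coord-nbr-same (cell p q hi) (suc (suc zero)) = third p q
  where
  third : ∀ p q → + 1 ℤ.- p ℤ.- q ≡ -1ℤ ℤ.+ (+ 2 ℤ.- p ℤ.- q)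
  third = solve-∀

coord-nbr-other : ∀ a i j → i ≢ j → coord (nbr a i) j ≡ coord a j
coord-nbr-other a zero zero i≢j = ⊥-elim (i≢j refl)
coord-nbr-other a (suc zero) (suc zero) i≢j = ⊥-elim (i≢j refl)
coord-nbr-other a (suc (suc zero)) (suc (suc zero)) i≢j = ⊥-elim (i≢j refl)
coord-nbr-other (cell p q lo) zero (suc zero) _ = refl
coord-nbr-other (cell p q lo) zero (suc (suc zero)) _ = third p q
  where
  third : ∀ p q → + 2 ℤ.- (p ℤ.+ 1ℤ) ℤ.- q ≡ + 1 ℤ.- p ℤ.- q
  third = solve-∀
coord-nbr-other (cell p q lo) (suc zero) zero _ = refl
coord-nbr-other (cell p q lo) (suc zero) (suc (suc zero)) _ = third p q
  where
  third : ∀ p q → + 2 ℤ.- p ℤ.- (q ℤ.+ 1ℤ) ≡ + 1 ℤ.- p ℤ.- q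
  third = solve-∀
coord-nbr-other (cell p q lo) (suc (suc zero)) zero _ = refl
coord-nbr-other (cell p q lo) (suc (suc zero)) (suc zero) _ = refl
coord-nbr-other (cell p q hi) zero (suc zero) _ = refl
coord-nbr-other (cell p q hi) zero (suc (suc zero)) _ = third p q
  where
  third : ∀ p q → + 1 ℤ.- (p ℤ.- 1ℤ) ℤ.- q ≡ + 2 ℤ.- p ℤ.- q
  third = solve-∀
coord-nbr-other (cell p q hi) (suc zero) zero _ = refl
coord-nbr-other (cell p q hi) (suc zero) (suc (suc zero)) _ = third p q
  where
  third : ∀ p q → + 1 ℤ.- p ℤ.- (q ℤ.- 1ℤ) ≡ + 2 ℤ.- p ℤ.- q
  third = solve-∀
coord-nbr-other (cell p q hi) (suc (suc zero)) zero _ = refl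
coord-nbr-other (cell p q hi) (suc (suc zero)) (suc zero) _ = refl

offset : Cell → Cell → Fin 3 → ℤ
offset a b j = coord a j ℤ.- coord b j

Σ₃ : (Fin 3 → ℕ) → ℕ
Σ₃ f = f zero ℕ.+ f (suc zero) ℕ.+ f (suc (suc zero))

gap : Cell → Cell → Fin 3 → ℕ
gap a b j = ∣ offset a b j ∣

dist : Cell → Cell → ℕ
dist a b = Σ₃ (gap a b)

offset-nbr-same : ∀ a i b → offset (nbr a i) b i ≡ sign (o a) ℤ.+ offset a b i
offset-nbr-same a i b = begin
  coord (nbr a i) i ℤ.- coord b i              ≡⟨ cong (ℤ._- coord b i) (coord-nbr-same a i) ⟩
  sign (o a) ℤ.+ coord a i ℤ.- coord b i       ≡⟨ ℤP.+-assoc (sign (o a)) (coord a i) (ℤ.- coord b i) ⟩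
  sign (o a) ℤ.+ (coord a i ℤ.- coord b i)     ∎
  where open ≡-Reasoning

Σ₃-step : ∀ (f g : Fin 3 → ℕ) i → (∀ j → i ≢ j → f j ≡ g j) → f i ≡ suc (g i) →
  Σ₃ f ≡ suc (Σ₃ g)
Σ₃-step f g zero others fi rewrite fi | others (suc zero) (λ ()) | others (suc (suc zero)) (λ ()) =
  refl
Σ₃-step f g (suc zero) others fi rewrite fi | others zero (λ ()) | others (suc (suc zero)) (λ ()) =
  cong (ℕ._+ g (suc (suc zero))) (ℕP.+-suc (g zero) (g (suc zero)))
Σ₃-step f g (suc (suc zero)) others fi rewrite fi | others zero (λ ()) | others (suc zero) (λ ()) =
  ℕP.+-suc (g zero ℕ.+ g (suc zero)) (g (suc (suc zero)))

Σ₃-subadditive : ∀ (f g h : Fin 3 → ℕ) → (∀ j → f j ≤ g j ℕ.+ h j) → Σ₃ f ≤ Σ₃ g ℕ.+ Σ₃ h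
Σ₃-subadditive f g h bound = ℕP.≤-trans
  (ℕP.+-mono-≤ (ℕP.+-mono-≤ (bound zero) (bound (suc zero))) (bound (suc (suc zero))))
  (ℕP.≤-reflexive (regroup (g zero) (h zero) (g (suc zero)) (h (suc zero))
                           (g (suc (suc zero))) (h (suc (suc zero)))))
  where
  regroup : ∀ a b c d e f → a ℕ.+ b ℕ.+ (c ℕ.+ d) ℕ.+ (e ℕ.+ f) ≡ a ℕ.+ c ℕ.+ e ℕ.+ (b ℕ.+ d ℕ.+ f)
  regroup = ℕSolver.solve-∀

dist-self : ∀ a → dist a a ≡ 0
dist-self a rewrite ℤP.+-inverseʳ (coord a zero) | ℤP.+-inverseʳ (coord a (suc zero))
                  | ℤP.+-inverseʳ (coord a (suc (suc zero))) = refl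

dist-sym : ∀ a b → dist a b ≡ dist b a
dist-sym a b rewrite ℤP.∣i-j∣≡∣j-i∣ (coord a zero) (coord b zero)
                   | ℤP.∣i-j∣≡∣j-i∣ (coord a (suc zero)) (coord b (suc zero))
                   | ℤP.∣i-j∣≡∣j-i∣ (coord a (suc (suc zero))) (coord b (suc (suc zero))) = refl

dist-triangle : ∀ a b c → dist a c ≤ dist a b ℕ.+ dist b c
dist-triangle a b c = Σ₃-subadditive (gap a c) (gap a b) (gap b c) λ j →
  subst (λ e → ∣ e ∣ ≤ ∣ offset a b j ∣ ℕ.+ ∣ offset b c j ∣)
        (telescope (coord a j) (coord b j) (coord c j))
        (ℤP.∣i+j∣≤∣i∣+∣j∣ (offset a b j) (offset b c j))
  where
  telescope : ∀ p q r → (p ℤ.- q) ℤ.+ (q ℤ.- r) ≡ p ℤ.- r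
  telescope = solve-∀

-- Sign condition on the offset e of a neighbour in the crossed coordinate saying that
-- the target lies in the half-plane S of the step (lo cells step up, hi cells down).
Toward : Ori → ℤ → Set
Toward lo e = e ℤ.≤ 0ℤ
Toward hi e = 0ℤ ℤ.≤ e

InS⇒toward : ∀ a i b → InS a i b → Toward (o a) (sign (o a) ℤ.+ offset a b i)
InS⇒toward a i b inS = subst (Toward (o a)) (offset-nbr-same a i b) (unshifted a inS)
  where
  unshifted : ∀ a → InS a i b → Toward (o a) (offset (nbr a i) b i)
  unshifted (cell p q lo) = ℤP.i≤j⇒i-j≤0
  unshifted (cell p q hi) = ℤP.i≤j⇒0≤j-i

toward⇒InS : ∀ a i b → Toward (o a) (sign (o a) ℤ.+ offset a b i) → InS a i b
toward⇒InS a i b t = unshifted a (subst (Toward (o a)) (sym (offset-nbr-same a i b)) t)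
  where
  unshifted : ∀ a → Toward (o a) (offset (nbr a i) b i) → InS a i b
  unshifted (cell p q lo) = ℤP.i-j≤0⇒i≤j
  unshifted (cell p q hi) = ℤP.0≤i-j⇒j≤i

InS? : ∀ a i b → Dec (InS a i b)
InS? (cell p q lo) i b = _ ℤ.≤? _
InS? (cell p q hi) i b = _ ℤ.≤? _

gap-toward : ∀ σ e → Toward σ (sign σ ℤ.+ e) → ∣ e ∣ ≡ suc ∣ sign σ ℤ.+ e ∣
gap-toward lo (+ n) (+≤+ ())
gap-toward lo -[1+ zero ] _ = refl
gap-toward lo -[1+ suc n ] _ = refl
gap-toward hi (+ zero) ()
gap-toward hi (+ suc n) _ = refl
gap-toward hi -[1+ n ] ()

gap-away : ∀ σ e → ¬ Toward σ (sign σ ℤ.+ e) → ∣ sign σ ℤ.+ e ∣ ≡ suc ∣ e ∣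
gap-away lo (+ n) _ = refl
gap-away lo -[1+ zero ] away = ⊥-elim (away (+≤+ z≤n))
gap-away lo -[1+ suc n ] away = ⊥-elim (away -≤+)
gap-away hi (+ zero) _ = refl
gap-away hi (+ suc n) away = ⊥-elim (away (+≤+ z≤n))
gap-away hi -[1+ n ] _ = refl

dist-toward : ∀ a i b → InS a i b → dist a b ≡ suc (dist (nbr a i) b)
dist-toward a i b inS = Σ₃-step (gap a b) (gap (nbr a i) b) i
  (λ j i≢j → sym (cong (λ e → ∣ e ℤ.- coord b j ∣) (coord-nbr-other a i j i≢j)))
  (trans (gap-toward (o a) (offset a b i) (InS⇒toward a i b inS))
         (cong (λ e → suc ∣ e ∣) (sym (offset-nbr-same a i b))))

dist-away : ∀ a i b → ¬ InS a i b → dist (nbr a i) b ≡ suc (dist a b)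
dist-away a i b outS = Σ₃-step (gap (nbr a i) b) (gap a b) i
  (λ j i≢j → cong (λ e → ∣ e ℤ.- coord b j ∣) (coord-nbr-other a i j i≢j))
  (trans (cong ∣_∣ (offset-nbr-same a i b))
         (gap-away (o a) (offset a b i) (λ t → outS (toward⇒InS a i b t))))

-- A cell lies in the half-plane of its own step.
dist-nbr : ∀ a i → dist a (nbr a i) ≡ 1
dist-nbr a i = trans (dist-toward a i (nbr a i) (own-side a i)) (cong suc (dist-self (nbr a i)))
  where
  own-side : ∀ a i → InS a i (nbr a i)
  own-side (cell p q lo) i = ℤP.≤-refl
  own-side (cell p q hi) i = ℤP.≤-refl

dist-nbr-left : ∀ a i b → dist a b ≤ suc (dist (nbr a i) b)
dist-nbr-left a i b =
  subst (λ n → dist a b ≤ n ℕ.+ dist (nbr a i) b) (dist-nbr a i) (dist-triangle a (nbr a i) b)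

dist-nbr-right : ∀ a b i → dist a (nbr b i) ≤ suc (dist a b)
dist-nbr-right a b i = subst (dist a (nbr b i) ≤_) (ℕP.+-comm (dist a b) 1)
  (subst (λ n → dist a (nbr b i) ≤ dist a b ℕ.+ n) (dist-nbr b i) (dist-triangle a b (nbr b i)))

Behind : Ori → ℤ → Set
Behind lo e = 0ℤ ℤ.≤ e
Behind hi e = e ℤ.≤ 0ℤ

not-toward⇒behind : ∀ σ e → ¬ Toward σ (sign σ ℤ.+ e) → Behind σ e
not-toward⇒behind lo (+ n) _ = +≤+ z≤n
not-toward⇒behind lo -[1+ zero ] away = ⊥-elim (away (+≤+ z≤n))
not-toward⇒behind lo -[1+ suc n ] away = ⊥-elim (away -≤+)
not-toward⇒behind hi (+ zero) _ = +≤+ z≤n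
not-toward⇒behind hi (+ suc n) away = ⊥-elim (away (+≤+ z≤n))
not-toward⇒behind hi -[1+ n ] _ = -≤+

squeeze : ∀ σ e₀ e₁ e₂ → Behind σ e₀ → Behind σ e₁ → Behind σ e₂ → Toward σ (e₀ ℤ.+ e₁ ℤ.+ e₂) →
  e₀ ≡ 0ℤ × e₁ ≡ 0ℤ × e₂ ≡ 0ℤ
squeeze lo (+ zero) (+ zero) (+ zero) _ _ _ _ = refl , refl , refl
squeeze lo (+ suc _) (+ _) (+ _) _ _ _ (+≤+ ())
squeeze lo (+ zero) (+ suc _) (+ _) _ _ _ (+≤+ ())
squeeze lo (+ zero) (+ zero) (+ suc _) _ _ _ (+≤+ ())
squeeze lo -[1+ _ ] _ _ () _ _ _
squeeze lo (+ _) -[1+ _ ] _ _ () _ _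
squeeze lo (+ _) (+ _) -[1+ _ ] _ _ () _
squeeze hi _ _ _ (+≤+ z≤n) (+≤+ z≤n) (+≤+ z≤n) _ = refl , refl , refl
squeeze hi _ _ _ (+≤+ z≤n) (+≤+ z≤n) -≤+ ()
squeeze hi _ _ _ (+≤+ z≤n) -≤+ (+≤+ z≤n) ()
squeeze hi _ _ _ (+≤+ z≤n) -≤+ -≤+ ()
squeeze hi _ _ _ -≤+ (+≤+ z≤n) (+≤+ z≤n) ()
squeeze hi _ _ _ -≤+ (+≤+ z≤n) -≤+ ()
squeeze hi _ _ _ -≤+ -≤+ (+≤+ z≤n) ()
squeeze hi _ _ _ -≤+ -≤+ -≤+ ()

offset-sum : ∀ a b → offset a b zero ℤ.+ offset a b (suc zero) ℤ.+ offset a b (suc (suc zero))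
                     ≡ osum (o a) ℤ.- osum (o b)
offset-sum (cell xa ya σ) (cell xb yb τ) = regroup xa xb ya yb (osum σ) (osum τ)
  where
  regroup : ∀ xa xb ya yb s t →
    (xa ℤ.- xb) ℤ.+ (ya ℤ.- yb) ℤ.+ ((s ℤ.- xa ℤ.- ya) ℤ.- (t ℤ.- xb ℤ.- yb)) ≡ s ℤ.- t
  regroup = solve-∀

osum-toward : ∀ σ τ → Toward σ (osum σ ℤ.- osum τ)
osum-toward lo lo = +≤+ z≤n
osum-toward lo hi = -≤+
osum-toward hi lo = +≤+ z≤n
osum-toward hi hi = +≤+ z≤n

osum-injective : ∀ σ τ → osum σ ℤ.- osum τ ≡ 0ℤ → σ ≡ τ
osum-injective lo lo _ = refl
osum-injective hi hi _ = refl

offsets-zero⇒equal : ∀ a b →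
  offset a b zero ≡ 0ℤ × offset a b (suc zero) ≡ 0ℤ × offset a b (suc (suc zero)) ≡ 0ℤ → a ≡ b
offsets-zero⇒equal a@(cell xa ya σ) b@(cell xb yb τ) (e₀ , e₁ , e₂) =
  cell-≡ (ℤP.i-j≡0⇒i≡j xa xb e₀) (ℤP.i-j≡0⇒i≡j ya yb e₁)
         (osum-injective σ τ (trans (sym (offset-sum a b)) (cong₂ ℤ._+_ (cong₂ ℤ._+_ e₀ e₁) e₂)))
  where
  cell-≡ : ∀ {xa xb ya yb σ τ} → xa ≡ xb → ya ≡ yb → σ ≡ τ → cell xa ya σ ≡ cell xb yb τ
  cell-≡ refl refl refl = refl

outside-all⇒equal : ∀ a b → (∀ i → ¬ InS a i b) → a ≡ b
outside-all⇒equal a b outside = offsets-zero⇒equal a b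
  (squeeze (o a) _ _ _ (behind zero) (behind (suc zero)) (behind (suc (suc zero)))
           (subst (Toward (o a)) (sym (offset-sum a b)) (osum-toward (o a) (o b))))
  where
  behind : ∀ j → Behind (o a) (offset a b j)
  behind j = not-toward⇒behind (o a) (offset a b j) (λ t → outside j (toward⇒InS a j b t))

toward-or-equal : ∀ a b → (∃[ i ] InS a i b) ⊎ a ≡ b
toward-or-equal a b with InS? a zero b | InS? a (suc zero) b | InS? a (suc (suc zero)) b
... | yes inS | _ | _ = inj₁ (zero , inS)
... | no _ | yes inS | _ = inj₁ (suc zero , inS)
... | no _ | no _ | yes inS = inj₁ (suc (suc zero) , inS)
... | no out₀ | no out₁ | no out₂ = inj₂ (outside-all⇒equal a b outside)
  where
  outside : ∀ i → ¬ InS a i b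
  outside zero = out₀
  outside (suc zero) = out₁
  outside (suc (suc zero)) = out₂

dist-zero : ∀ a b → dist a b ≡ 0 → a ≡ b
dist-zero a b d≡0 with toward-or-equal a b
... | inj₁ (i , inS) = ⊥-elim (ℕP.0≢1+n (trans (sym d≡0) (dist-toward a i b inS)))
... | inj₂ a≡b = a≡b

walk-of-dist : ∀ n a b → dist a b ≡ n → Walk a b n
walk-of-dist zero a b d≡0 = subst (λ b → Walk a b 0) (dist-zero a b d≡0) here
walk-of-dist (suc n) a b d≡n with toward-or-equal a b
... | inj₁ (i , inS) =
  step i (walk-of-dist n (nbr a i) b (ℕP.suc-injective (trans (sym (dist-toward a i b inS)) d≡n)))
... | inj₂ refl = ⊥-elim (ℕP.0≢1+n (trans (sym (dist-self a)) d≡n))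

dist-≤-walk : ∀ {a b n} → Walk a b n → dist a b ≤ n
dist-≤-walk {a} here = ℕP.≤-reflexive (dist-self a)
dist-≤-walk {a} {b} (step i walk) = ℕP.≤-trans (dist-nbr-left a i b) (s≤s (dist-≤-walk walk))

dist-Dist : ∀ a b → Dist a b (dist a b)
dist-Dist a b = walk-of-dist _ a b refl , λ m m<d walk → ℕP.<⇒≱ m<d (dist-≤-walk walk)

Dist⇒dist : ∀ {a b d} → Dist a b d → dist a b ≡ d
Dist⇒dist {a} {b} (walk , minimal) = ℕP.≤-antisym (dist-≤-walk walk)
  (ℕP.≮⇒≥ (λ d<n → minimal _ d<n (walk-of-dist _ a b refl)))

-- Rule 12 at one cell with own state s and neighbour states f; 'rule12 c x' unfolds to
-- 'local12 (c x) (λ k → c (nbr x k))'.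
count : (Fin 3 → Bool) → ℕ
count f = b2n (f zero) ℕ.+ b2n (f (suc zero)) ℕ.+ b2n (f (suc (suc zero)))

local12 : Bool → (Fin 3 → Bool) → Bool
local12 s f = s ∨ ((count f ≡ᵇ 1) ∨ (count f ≡ᵇ 2))

local12-sources : ∀ s f → local12 s f ≡ true → s ≡ true ⊎ ∃[ i ] f i ≡ true
local12-sources true f _ = inj₁ refl
local12-sources false f fires with f zero in f₀ | f (suc zero) in f₁ | f (suc (suc zero)) in f₂
... | true | _ | _ = inj₂ (zero , f₀)
... | false | true | _ = inj₂ (suc zero , f₁)
... | false | false | true = inj₂ (suc (suc zero) , f₂)
local12-sources false f () | false | false | false

-- Neighbour states that are not all equal make one or two active neighbours.
local12-fires : ∀ s f i j → f i ≡ true → f j ≢ true → local12 s f ≡ true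
local12-fires true f i j _ _ = refl
local12-fires false f i j on off with f zero in f₀ | f (suc zero) in f₁ | f (suc (suc zero)) in f₂
... | true | true | true = ⊥-elim (off (constant j))
  where
  constant : ∀ j → f j ≡ true
  constant zero = f₀
  constant (suc zero) = f₁
  constant (suc (suc zero)) = f₂
... | false | false | false = ⊥-elim (false≢true (trans (sym (constant i)) on))
  where
  constant : ∀ j → f j ≡ false
  constant zero = f₀
  constant (suc zero) = f₁
  constant (suc (suc zero)) = f₂
  false≢true : false ≢ true
  false≢true ()
... | true | true | false = refl
... | true | false | true = refl
... | true | false | false = refl
... | false | true | true = refl
... | false | true | false = refl
... | false | false | true = refl

light-cone : ∀ c t x → iter rule12 t c x ≡ true → ∃[ w ] (c w ≡ true × dist x w ≤ t)
light-cone c zero x active = x , active , ℕP.≤-reflexive (dist-self x)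
light-cone c (suc t) x active
  with local12-sources (iter rule12 t c x) (λ k → iter rule12 t c (nbr x k)) active
... | inj₁ was-active with light-cone c t x was-active
...   | w , cw , near = w , cw , ℕP.m≤n⇒m≤1+n near
light-cone c (suc t) x active | inj₂ (i , nbr-active) with light-cone c t (nbr x i) nbr-active
...   | w , cw , near = w , cw , ℕP.≤-trans (dist-nbr-left x i w) (s≤s near)

module Wavefront (c : Config) (u w : Cell) (w-active : c w ≡ true)
                 (nearest : ∀ w' → c w' ≡ true → dist u w ≤ dist u w') where

  -- A neighbour of a geodesic cell x one step closer to u is still inactive at time k:
  -- by the light cone it would otherwise be fed by an active cell closer to u than d.
  toward-u-inactive : ∀ k x i → InS x i u → dist u x ℕ.+ k ≤ dist u w →
    iter rule12 k c (nbr x i) ≢ true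
  toward-u-inactive k x i toward-u on-geodesic active with light-cone c k (nbr x i) active
  ... | w' , cw' , near = ℕP.<-irrefl refl (begin-strict
    dist u z ℕ.+ k          <⟨ ℕP.n<1+n _ ⟩
    suc (dist u z) ℕ.+ k    ≡⟨ cong (ℕ._+ k) u-x ⟩
    dist u x ℕ.+ k          ≤⟨ on-geodesic ⟩
    dist u w                ≤⟨ nearest w' cw' ⟩
    dist u w'               ≤⟨ dist-triangle u z w' ⟩
    dist u z ℕ.+ dist z w'  ≤⟨ ℕP.+-monoʳ-≤ (dist u z) near ⟩
    dist u z ℕ.+ k          ∎)
    where
    open ℕP.≤-Reasoning
    z : Cell
    z = nbr x i
    u-x : suc (dist u z) ≡ dist u x
    u-x = begin-equality
      suc (dist u z)  ≡⟨ cong suc (dist-sym u z) ⟩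
      suc (dist z u)  ≡⟨ sym (dist-toward x i u toward-u) ⟩
      dist x u        ≡⟨ dist-sym x u ⟩
      dist u x        ∎

  wavefront : ∀ k x → dist x w ≡ k → dist u x ℕ.+ k ≤ dist u w → k < dist u w →
    iter rule12 k c x ≡ true
  wavefront zero x x-w _ _ = subst (λ y → c y ≡ true) (sym (dist-zero x w x-w)) w-active
  wavefront (suc k) x x-w on-geodesic k<d with toward-or-equal x w | toward-or-equal x u
  ... | inj₂ refl | _ = ⊥-elim (ℕP.0≢1+n (trans (sym (dist-self x)) x-w))
  ... | inj₁ _ | inj₂ refl = ⊥-elim (ℕP.<-irrefl (sym x-w) k<d)
  ... | inj₁ (i , toward-w) | inj₁ (j , toward-u) =
    local12-fires (iter rule12 k c x) (λ l → iter rule12 k c (nbr x l)) i j behind-active ahead-inactive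
    where
    -- the neighbour towards w is on the geodesic one step nearer to w
    behind-active : iter rule12 k c (nbr x i) ≡ true
    behind-active = wavefront k (nbr x i)
      (ℕP.suc-injective (trans (sym (dist-toward x i w toward-w)) x-w))
      (ℕP.≤-trans (ℕP.+-monoˡ-≤ k (dist-nbr-right u x i))
                  (subst (ℕ._≤ dist u w) (ℕP.+-suc (dist u x) k) on-geodesic))
      (ℕP.<⇒≤ k<d)

    ahead-inactive : iter rule12 k c (nbr x j) ≢ true
    ahead-inactive = toward-u-inactive k x j toward-u
      (ℕP.≤-trans (ℕP.+-monoʳ-≤ (dist u x) (ℕP.n≤1+n k)) on-geodesic)

source-of-activity : ∀ c u i t → (∀ w → c w ≡ true → suc t ≤ dist u w) →
  iter rule12 t c (nbr u i) ≡ true → ∃[ w ] (InS u i w × dist u w ≡ suc t × c w ≡ true)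
source-of-activity c u i t nearest active with light-cone c t (nbr u i) active
... | w , cw , near with InS? u i w
...   | yes inS = w , inS , ℕP.≤-antisym u-w≤ (nearest w cw) , cw
  where
  u-w≤ : dist u w ≤ suc t
  u-w≤ = subst (_≤ suc t) (sym (dist-toward u i w inS)) (s≤s near)
...   | no outS = ⊥-elim (ℕP.1+n≰n (begin
  suc t                     ≤⟨ nearest w cw ⟩
  dist u w                  ≤⟨ ℕP.n≤1+n _ ⟩
  suc (dist u w)            ≡⟨ sym (dist-away u i w outS) ⟩
  dist (nbr u i) w          ≤⟨ near ⟩
  t                         ∎))
  where open ℕP.≤-Reasoning

first-wave : ∀ c u i t w → (∀ w' → c w' ≡ true → suc t ≤ dist u w') →
  InS u i w → dist u w ≡ suc t → c w ≡ true → iter rule12 t c (nbr u i) ≡ true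
first-wave c u i t w nearest inS u-w cw = Wavefront.wavefront c u w cw nearest-w t (nbr u i)
  (ℕP.suc-injective (trans (sym (dist-toward u i w inS)) u-w))
  (ℕP.≤-reflexive (trans (cong (ℕ._+ t) (dist-nbr u i)) (sym u-w)))
  (subst (t <_) (sym u-w) (ℕP.n<1+n t))
  where
  nearest-w : ∀ w' → c w' ≡ true → dist u w ≤ dist u w'
  nearest-w w' cw' = subst (_≤ dist u w') (sym u-w) (nearest w' cw')

lemma2 : (c : Config) (u : Cell) (d : ℕ) → 2 ≤ d → NearestActiveDist c u d →
    (i : Fin 3) →
    ((iter rule12 (d ∸ 1) c (nbr u i) ≡ true) ⇔
      (∃[ w ] (InS u i w × w ∈D[ d ] u × c w ≡ true)))
lemma2 c u (suc t) _ (_ , nearest) i = mk⇔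
  (λ active → let w , inS , u-w , cw = source-of-activity c u i t nearest-dist active
              in w , inS , subst (Dist u w) u-w (dist-Dist u w) , cw)
  (λ (w , inS , u-w , cw) → first-wave c u i t w nearest-dist inS (Dist⇒dist u-w) cw)
  where
  nearest-dist : ∀ w → c w ≡ true → suc t ≤ dist u w
  nearest-dist w cw = nearest w (dist u w) cw (dist-Dist u w)
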